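{- Let $(L_n)_{n\ge0}$ be the Lucas sequence. Let $\mathcal X_0$ be the set of positive integers of the form $L_0+\sum_{i\in I}L_i$ where $I$ is a finite (possibly empty) subset of $\{3,4,5,\ldots\}$ containing no two consecutive integers, and let $q_0(1)<q_0(2)<\cdots$ be its elements in increasing order. Let $S$ be the golden string. Then for every $j\ge 1$, $$q_0(j+1)-q_0(j)=\begin{cases}L_2,&\text{if the $j$th character of $S$ is $A$},\\ L_3,&\text{if the $j$th character of $S$ is $B$}.\end{cases}$$
   Context: $L_0=2$, $L_1=1$, $L_n=L_{n-1}+L_{n-2}$ ($n\ge2$). The golden string $S=BABBABABBABBA\ldots$ is the infinite string over $\{A,B\}$ defined by $S_1=A$, $S_2=B$, $S_k=S_{k-1}S_{k-2}$ (concatenation) for $k\ge3$; each $S_k$ ($k\ge2$) is a prefix of $S_{k+1}$ and $S$ is the limit string. -}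

module Defs where

open import Data.Nat using (ℕ; zero; suc; _+_; _≤_; _<_)
open import Data.List using (List; []; _∷_; _++_; length; map)
open import Data.Nat.ListAction using (sum)
open import Data.List.Relation.Unary.All using (All)
open import Data.List.Membership.Propositional using (_∈_)
open import Data.Maybe using (Maybe; just; nothing)
open import Data.Product using (Σ; _×_)
open import Relation.Binary.PropositionalEquality using (_≡_)

L : ℕ → ℕ
L zero = 2
L (suc zero) = 1
L (suc (suc n)) = L (suc n) + L n

-- A finite set I of naturals with no two consecutive integers, represented
-- canonically as its list of elements in increasing order, consecutive
-- entries differing by at least 2.
data Sparse : List ℕ → Set where
  []  : Sparse []
  [_] : (x : ℕ) → Sparse (x ∷ [])
  _∷_ : ∀ {x y ys} → x + 2 ≤ y → Sparse (y ∷ ys) → Sparse (x ∷ y ∷ ys)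

X0 : ℕ → Set
X0 n = Σ (List ℕ) λ I → Sparse I × All (3 ≤_) I × n ≡ L 0 + sum (map L I)

data Increasing : List ℕ → Set where
  []  : Increasing []
  [_] : (x : ℕ) → Increasing (x ∷ [])
  _∷_ : ∀ {x y ys} → x < y → Increasing (y ∷ ys) → Increasing (x ∷ y ∷ ys)

-- Q0 j a : a = q₀(j), the j-th smallest element of 𝒳₀ (1-indexed), i.e.
-- the elements of 𝒳₀ that are ≤ a are exactly the entries of a strictly
-- increasing list of length j whose last entry is a.
Q0 : ℕ → ℕ → Set
Q0 j a = Σ (List ℕ) λ xs →
           Increasing (xs ++ (a ∷ []))
         × suc (length xs) ≡ j
         × All X0 (xs ++ (a ∷ []))
         × (∀ x → X0 x → x ≤ a → x ∈ (xs ++ (a ∷ [])))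

data Letter : Set where
  A B : Letter

goldenS : ℕ → List Letter          -- goldenS k = S_k  (k ≥ 1; goldenS 0 unused)
goldenS zero = []
goldenS (suc zero) = A ∷ []
goldenS (suc (suc zero)) = B ∷ []
goldenS (suc (suc (suc k))) = goldenS (suc (suc k)) ++ goldenS (suc k)

-- 1-indexed character lookup
charAt : List Letter → ℕ → Maybe Letter
charAt []       _             = nothing
charAt (c ∷ cs) zero          = nothing
charAt (c ∷ cs) (suc zero)    = just c
charAt (c ∷ cs) (suc (suc j)) = charAt cs (suc j)

-- j-th character of S (j ≥ 1): S_{j+2} is a prefix of S of length ≥ j
goldenChar : ℕ → Maybe Letter
goldenChar j = charAt (goldenS (j + 2)) j

gap : Letter → ℕ
gap A = L 2
gap B = L 3

module Submission where

-- Walk from L 0 = 2, stepping by L 2 on A and by L 3 on B.  Along S_{n+1} the walk visits, in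
-- increasing order, exactly the elements of 𝒳₀ whose index set lies in {3, …, n+1}: since
-- S_{n+3} = S_{n+2} S_{n+1} and the walk along S_{n+2} ends at L_{n+3} + 2, the second half of the
-- walk along S_{n+3} visits L_{n+3} plus the points of the walk along S_{n+1}, mirroring the split of
-- 𝒳₀ according to whether n+3 ∈ I.  These enumerations are nested and exhaust 𝒳₀, so q₀(j) is the
-- j-th point of the walk along S, and q₀(j+1) − q₀(j) is its j-th step.

open import Defs
open import Data.Nat using (ℕ; zero; suc; _+_; _≤_; _<_; _≤′_; ≤′-refl; ≤′-step; z≤n; s≤s; s≤s⁻¹)
open import Data.Nat.Properties
open import Data.Maybe using (just)
open import Data.Product using (Σ; _×_; _,_)
open import Data.List using (List; []; _∷_; _++_; length; map)
open import Data.List.Properties using (++-assoc; ++-identityʳ; length-++; map-++)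
open import Data.Nat.ListAction.Properties using (sum-++)
open import Data.Nat.ListAction using (sum)
open import Data.List.Relation.Unary.All as All using (All; []; _∷_)
open import Data.List.Relation.Unary.All.Properties using (++⁺; ++⁻ˡ; ++⁻ʳ; map⁺)
open import Data.List.Relation.Unary.Any using (here; there)
open import Data.List.Membership.Propositional using (_∈_)
open import Data.List.Membership.Propositional.Properties using (∈-++⁺ˡ; ∈-++⁺ʳ; ∈-map⁺)
open import Relation.Binary.PropositionalEquality
open import Relation.Nullary using (yes; no; contradiction)

module Walk {A : Set} (step : A → ℕ) where

  positions : ℕ → List A → List ℕ
  positions x []       = []
  positions x (c ∷ cs) = x ∷ positions (x + step c) cs

  endpoint : ℕ → List A → ℕ
  endpoint x []       = x
  endpoint x (c ∷ cs) = endpoint (x + step c) cs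

  positions-++ : ∀ x s t → positions x (s ++ t) ≡ positions x s ++ positions (endpoint x s) t
  positions-++ x []      t = refl
  positions-++ x (c ∷ s) t = cong (x ∷_) (positions-++ (x + step c) s t)

  endpoint-++ : ∀ x s t → endpoint x (s ++ t) ≡ endpoint (endpoint x s) t
  endpoint-++ x []      t = refl
  endpoint-++ x (c ∷ s) t = endpoint-++ (x + step c) s t

  positions-+ : ∀ k x s → positions (k + x) s ≡ map (k +_) (positions x s)
  positions-+ k x []      = refl
  positions-+ k x (c ∷ s) = cong ((k + x) ∷_)
    (trans (cong (λ y → positions y s) (+-assoc k x (step c))) (positions-+ k (x + step c) s))

  endpoint-+ : ∀ k x s → endpoint (k + x) s ≡ k + endpoint x s
  endpoint-+ k x []      = refl
  endpoint-+ k x (c ∷ s) =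
    trans (cong (λ y → endpoint y s) (+-assoc k x (step c))) (endpoint-+ k (x + step c) s)

  length-positions : ∀ x s → length (positions x s) ≡ length s
  length-positions x []      = refl
  length-positions x (c ∷ s) = cong suc (length-positions (x + step c) s)

  positions-++-∷ : ∀ x s t c → Σ (List ℕ) λ rest → positions x (s ++ c ∷ t) ≡ x ∷ rest
  positions-++-∷ x []      t c = _ , refl
  positions-++-∷ x (_ ∷ s) t c = _ , refl

  positions-increasing : (∀ c → 0 < step c) → ∀ x s → Increasing (positions x s)
  positions-increasing pos x []          = []
  positions-increasing pos x (c ∷ [])    = [ x ]
  positions-increasing pos x (c ∷ d ∷ s) =
    m<m+n x (pos c) ∷ positions-increasing pos (x + step c) (d ∷ s)

open Walk gap

increasing-tail : ∀ {x xs} → Increasing (x ∷ xs) → Increasing xs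
increasing-tail [ x ]   = []
increasing-tail (_ ∷ r) = r

increasing-++⁻ˡ : ∀ xs {ys} → Increasing (xs ++ ys) → Increasing xs
increasing-++⁻ˡ []           _       = []
increasing-++⁻ˡ (x ∷ [])     _       = [ x ]
increasing-++⁻ˡ (x ∷ y ∷ xs) (h ∷ r) = h ∷ increasing-++⁻ˡ (y ∷ xs) r

increasing-head-< : ∀ {a zs x} → Increasing (a ∷ zs) → x ∈ zs → a < x
increasing-head-< (h ∷ r) (here refl) = h
increasing-head-< (h ∷ r) (there x∈) = <-trans h (increasing-head-< r x∈)

increasing-∈-≤ : ∀ pre {a zs x} → Increasing (pre ++ a ∷ zs) →
  x ∈ pre ++ a ∷ zs → x ≤ a → x ∈ pre ++ a ∷ []
increasing-∈-≤ []        inc (here x≡a)  _   = here x≡a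
increasing-∈-≤ []        inc (there x∈)  x≤a = contradiction x≤a (<⇒≱ (increasing-head-< inc x∈))
increasing-∈-≤ (y ∷ pre) inc (here x≡y)  _   = here x≡y
increasing-∈-≤ (y ∷ pre) inc (there x∈)  x≤a = there (increasing-∈-≤ pre (increasing-tail inc) x∈ x≤a)

lucasSum : List ℕ → ℕ
lucasSum I = L 0 + sum (map L I)

lucasSum-∷ʳ : ∀ I m → lucasSum (I ++ m ∷ []) ≡ L m + lucasSum I
lucasSum-∷ʳ I m = begin
  2 + sum (map L (I ++ m ∷ []))   ≡⟨ cong (λ xs → 2 + sum xs) (map-++ L I (m ∷ [])) ⟩
  2 + sum (map L I ++ L m ∷ [])   ≡⟨ cong (2 +_) (sum-++ (map L I) (L m ∷ [])) ⟩
  2 + (sum (map L I) + (L m + 0)) ≡⟨ cong (λ y → 2 + (sum (map L I) + y)) (+-identityʳ (L m)) ⟩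
  2 + (sum (map L I) + L m)       ≡⟨ +-assoc 2 (sum (map L I)) (L m) ⟨
  lucasSum I + L m                ≡⟨ +-comm (lucasSum I) (L m) ⟩
  L m + lucasSum I                ∎
  where open ≡-Reasoning

X0≤ : ℕ → ℕ → Set
X0≤ n u = Σ (List ℕ) λ I → Sparse I × All (3 ≤_) I × All (_≤ n) I × u ≡ lucasSum I

X0≤⇒X0 : ∀ {n u} → X0≤ n u → X0 u
X0≤⇒X0 (I , sp , I≥3 , _ , u≡) = I , sp , I≥3 , u≡

X0≤-suc : ∀ {n u} → X0≤ n u → X0≤ (suc n) u
X0≤-suc (I , sp , I≥3 , I≤n , u≡) = I , sp , I≥3 , All.map m≤n⇒m≤1+n I≤n , u≡

∈⇒≤-sum : ∀ {i} I → i ∈ I → i ≤ sum I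
∈⇒≤-sum (i ∷ I) (here refl) = m≤m+n i (sum I)
∈⇒≤-sum (j ∷ I) (there i∈) = ≤-trans (∈⇒≤-sum I i∈) (m≤n+m (sum I) j)

X0⇒X0≤ : ∀ {u} → X0 u → Σ ℕ λ n → X0≤ n u
X0⇒X0≤ (I , sp , I≥3 , u≡) = sum I , I , sp , I≥3 , All.tabulate (∈⇒≤-sum I) , u≡

m+2≤2+n⇒m≤n : ∀ {m n} → m + 2 ≤ 2 + n → m ≤ n
m+2≤2+n⇒m≤n {m} {n} h = s≤s⁻¹ (s≤s⁻¹ (subst (_≤ 2 + n) (+-comm m 2) h))

m≤n⇒m+2≤2+n : ∀ {m n} → m ≤ n → m + 2 ≤ 2 + n
m≤n⇒m+2≤2+n {m} {n} h = subst (_≤ 2 + n) (+-comm 2 m) (s≤s (s≤s h))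

data SparseSnoc : List ℕ → Set where
  []   : SparseSnoc []
  snoc : ∀ {I} → Sparse I → (m : ℕ) → All (λ i → i + 2 ≤ m) I → SparseSnoc (I ++ m ∷ [])

sparse-∷ʳ : ∀ {I m} → Sparse I → All (λ i → i + 2 ≤ m) I → Sparse (I ++ m ∷ [])
sparse-∷ʳ {m = m} []      []          = [ m ]
sparse-∷ʳ {m = m} [ x ]   (h ∷ [])    = h ∷ [ m ]
sparse-∷ʳ         (p ∷ s) (_ ∷ bound) = p ∷ sparse-∷ʳ s bound

sparseSnoc : ∀ {I} → Sparse I → SparseSnoc I
sparseSnoc []          = []
sparseSnoc [ x ]       = snoc [] x []
sparseSnoc (x+2≤y ∷ s) = cons x+2≤y (sparseSnoc s) refl
  where
  cons : ∀ {x y ys J} → x + 2 ≤ y → SparseSnoc J → J ≡ y ∷ ys → SparseSnoc (x ∷ J)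
  cons         x+2≤y (snoc [] m [])                  refl = snoc [ _ ] m (x+2≤y ∷ [])
  cons {y = y} x+2≤y (snoc sp m (y+2≤m ∷ bound)) refl =
    snoc (x+2≤y ∷ sp) m (≤-trans x+2≤y (≤-trans (m≤m+n y 2) y+2≤m) ∷ y+2≤m ∷ bound)

goldenPositions : ℕ → List ℕ
goldenPositions n = positions (L 0) (goldenS (suc n))

endpoint-goldenS : ∀ n → endpoint (L 0) (goldenS (suc n)) ≡ L (suc (suc n)) + L 0
endpoint-goldenS zero          = refl
endpoint-goldenS (suc zero)    = refl
endpoint-goldenS (suc (suc n)) = begin
  endpoint (L 0) (goldenS (2 + n) ++ goldenS (1 + n))         ≡⟨ endpoint-++ (L 0) (goldenS (2 + n)) (goldenS (1 + n)) ⟩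
  endpoint (endpoint (L 0) (goldenS (2 + n))) (goldenS (1 + n)) ≡⟨ cong (λ y → endpoint y (goldenS (1 + n))) (endpoint-goldenS (suc n)) ⟩
  endpoint (L (3 + n) + L 0) (goldenS (1 + n))                ≡⟨ endpoint-+ (L (3 + n)) (L 0) (goldenS (1 + n)) ⟩
  L (3 + n) + endpoint (L 0) (goldenS (1 + n))                ≡⟨ cong (L (3 + n) +_) (endpoint-goldenS n) ⟩
  L (3 + n) + (L (2 + n) + L 0)                               ≡⟨ +-assoc (L (3 + n)) (L (2 + n)) (L 0) ⟨
  L (4 + n) + L 0                                             ∎
  where open ≡-Reasoning

goldenPositions-recurrence : ∀ n →
  goldenPositions (2 + n) ≡ goldenPositions (1 + n) ++ map (L (3 + n) +_) (goldenPositions n)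
goldenPositions-recurrence n = begin
  positions (L 0) (goldenS (2 + n) ++ goldenS (1 + n))       ≡⟨ positions-++ (L 0) (goldenS (2 + n)) (goldenS (1 + n)) ⟩
  goldenPositions (1 + n) ++ positions (endpoint (L 0) (goldenS (2 + n))) (goldenS (1 + n))
    ≡⟨ cong (λ y → goldenPositions (1 + n) ++ positions y (goldenS (1 + n))) (endpoint-goldenS (suc n)) ⟩
  goldenPositions (1 + n) ++ positions (L (3 + n) + L 0) (goldenS (1 + n))
    ≡⟨ cong (goldenPositions (1 + n) ++_) (positions-+ (L (3 + n)) (L 0) (goldenS (1 + n))) ⟩
  goldenPositions (1 + n) ++ map (L (3 + n) +_) (goldenPositions n) ∎
  where open ≡-Reasoning

goldenPositions-prefix : ∀ {m n} → m ≤′ n → Σ (List ℕ) λ r → goldenPositions n ≡ goldenPositions m ++ r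
goldenPositions-prefix {m} ≤′-refl = [] , sym (++-identityʳ (goldenPositions m))
goldenPositions-prefix {m} (≤′-step {n} m≤′n) with goldenPositions-prefix m≤′n
... | r , Un≡ = r ++ next n , (begin
  goldenPositions (suc n)            ≡⟨ suc-prefix n ⟩
  goldenPositions n ++ next n        ≡⟨ cong (_++ next n) Un≡ ⟩
  (goldenPositions m ++ r) ++ next n ≡⟨ ++-assoc (goldenPositions m) r (next n) ⟩
  goldenPositions m ++ r ++ next n   ∎)
  where
  open ≡-Reasoning
  next : ℕ → List ℕ
  next zero    = []
  next (suc n) = map (L (3 + n) +_) (goldenPositions n)
  suc-prefix : ∀ n → goldenPositions (suc n) ≡ goldenPositions n ++ next n
  suc-prefix zero    = refl
  suc-prefix (suc n) = goldenPositions-recurrence n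

goldenPositions-increasing : ∀ n → Increasing (goldenPositions n)
goldenPositions-increasing n = positions-increasing gap-positive (L 0) (goldenS (suc n))
  where
  gap-positive : ∀ c → 0 < gap c
  gap-positive A = s≤s z≤n
  gap-positive B = s≤s z≤n

X0≤-extend : ∀ {n u} → X0≤ (suc n) u → X0≤ (3 + n) (L (3 + n) + u)
X0≤-extend {n} (I , sp , I≥3 , I≤ , refl) =
  I ++ 3 + n ∷ [] ,
  sparse-∷ʳ sp (All.map m≤n⇒m+2≤2+n I≤) ,
  ++⁺ I≥3 (s≤s (s≤s (s≤s z≤n)) ∷ []) ,
  ++⁺ (All.map (λ i≤ → m≤n⇒m≤1+n (m≤n⇒m≤1+n i≤)) I≤) (≤-refl ∷ []) ,
  sym (lucasSum-∷ʳ I (3 + n))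

goldenPositions-X0≤ : ∀ n → All (X0≤ (suc n)) (goldenPositions n)
goldenPositions-X0≤ zero          = ([] , [] , [] , [] , refl) ∷ []
goldenPositions-X0≤ (suc zero)    = ([] , [] , [] , [] , refl) ∷ []
goldenPositions-X0≤ (suc (suc n)) =
  subst (All (X0≤ (3 + n))) (sym (goldenPositions-recurrence n))
    (++⁺ (All.map X0≤-suc (goldenPositions-X0≤ (suc n)))
         (map⁺ (All.map X0≤-extend (goldenPositions-X0≤ n))))

∈-goldenPositions-suc : ∀ n {u} → u ∈ goldenPositions (1 + n) → u ∈ goldenPositions (2 + n)
∈-goldenPositions-suc n u∈ = subst (_ ∈_) (sym (goldenPositions-recurrence n)) (∈-++⁺ˡ u∈)

-- Split off the largest index m of I: either m ≤ n + 2, or m = n + 3 and the other indices are ≤ n + 1.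
X0≤⇒∈-goldenPositions-step : ∀ n →
  (∀ {u} → X0≤ (2 + n) u → u ∈ goldenPositions (1 + n)) →
  (∀ {u} → X0≤ (1 + n) u → u ∈ goldenPositions n) →
  ∀ {u} → X0≤ (3 + n) u → u ∈ goldenPositions (2 + n)
X0≤⇒∈-goldenPositions-step n previous earlier (I , sp , I≥3 , I≤ , refl) with sparseSnoc sp
... | [] = ∈-goldenPositions-suc n (previous ([] , [] , [] , [] , refl))
... | snoc {I′} sp′ m I′+2≤m with m ≤? 2 + n
...   | yes m≤2+n = ∈-goldenPositions-suc n (previous (I′ ++ m ∷ [] , sp , I≥3 , I′++m≤2+n , refl))
  where
  I′++m≤2+n : All (_≤ 2 + n) (I′ ++ m ∷ [])
  I′++m≤2+n = ++⁺ (All.map (λ i+2≤m → ≤-trans (m≤m+n _ 2) (≤-trans i+2≤m m≤2+n)) I′+2≤m) (m≤2+n ∷ [])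
...   | no m≰2+n with ≤-antisym (All.head (++⁻ʳ I′ I≤)) (≰⇒> m≰2+n)
...     | refl = subst₂ _∈_ (sym (lucasSum-∷ʳ I′ (3 + n))) (sym (goldenPositions-recurrence n))
          (∈-++⁺ʳ (goldenPositions (1 + n)) (∈-map⁺ (L (3 + n) +_)
            (earlier (I′ , sp′ , ++⁻ˡ I′ I≥3 , All.map m+2≤2+n⇒m≤n I′+2≤m , refl))))

X0≤⇒∈-goldenPositions : ∀ n {u} → X0≤ (suc n) u → u ∈ goldenPositions n
X0≤⇒∈-goldenPositions zero       ([] , _ , _ , _ , refl) = here refl
X0≤⇒∈-goldenPositions zero       (_ ∷ _ , _ , s≤s (s≤s (s≤s _)) ∷ _ , s≤s () ∷ _ , _)
X0≤⇒∈-goldenPositions (suc zero) ([] , _ , _ , _ , refl) = here refl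
X0≤⇒∈-goldenPositions (suc zero) (_ ∷ _ , _ , s≤s (s≤s (s≤s _)) ∷ _ , s≤s (s≤s ()) ∷ _ , _)
X0≤⇒∈-goldenPositions (suc (suc n)) =
  X0≤⇒∈-goldenPositions-step n (X0≤⇒∈-goldenPositions (suc n)) (X0≤⇒∈-goldenPositions n)

X0⇒∈-goldenPositions : ∀ {x} → X0 x → Σ ℕ λ n → x ∈ goldenPositions n
X0⇒∈-goldenPositions x∈X0 with X0⇒X0≤ x∈X0
... | n , x∈X0≤ = n , X0≤⇒∈-goldenPositions n (X0≤-suc x∈X0≤)

Q0-at : ∀ m pre a zs {j} → goldenPositions m ≡ pre ++ a ∷ zs → length pre ≡ j → Q0 (suc j) a
Q0-at m pre a zs Um≡ |pre|≡j =
  pre ,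
  increasing-++⁻ˡ (pre ++ a ∷ []) (subst Increasing Um≡′ (goldenPositions-increasing m)) ,
  cong suc |pre|≡j ,
  ++⁻ˡ (pre ++ a ∷ []) (subst (All X0) Um≡′ (All.map X0≤⇒X0 (goldenPositions-X0≤ m))) ,
  complete
  where
  Um≡′ : goldenPositions m ≡ (pre ++ a ∷ []) ++ zs
  Um≡′ = trans Um≡ (sym (++-assoc pre (a ∷ []) zs))
  complete : ∀ x → X0 x → x ≤ a → x ∈ pre ++ a ∷ []
  complete x x∈X0 x≤a with X0⇒∈-goldenPositions x∈X0
  ... | n , x∈Un with goldenPositions-prefix (≤⇒≤′ (m≤m+n n m)) | goldenPositions-prefix (≤⇒≤′ (m≤n+m m n))
  ...   | r , Un+m≡ | r′ , Un+m≡′ =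
    increasing-∈-≤ pre (subst Increasing Un+m≡″ (goldenPositions-increasing (n + m)))
                       (subst (x ∈_) Un+m≡″ (subst (x ∈_) (sym Un+m≡) (∈-++⁺ˡ x∈Un)))
                       x≤a
    where
    Un+m≡″ : goldenPositions (n + m) ≡ pre ++ a ∷ zs ++ r′
    Un+m≡″ = trans Un+m≡′ (trans (cong (_++ r′) Um≡) (++-assoc pre (a ∷ zs) r′))

length-goldenS : ∀ n → n < length (goldenS (2 + n))
length-goldenS zero          = s≤s z≤n
length-goldenS (suc zero)    = s≤s (s≤s z≤n)
length-goldenS (suc (suc n)) = begin
  3 + n                                                ≡⟨ +-comm 1 (2 + n) ⟩
  2 + n + 1                                            ≤⟨ +-mono-≤ (length-goldenS (suc n)) (≤-trans (s≤s z≤n) (length-goldenS n)) ⟩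
  length (goldenS (3 + n)) + length (goldenS (2 + n))  ≡⟨ length-++ (goldenS (3 + n)) ⟨
  length (goldenS (4 + n))                             ∎
  where open ≤-Reasoning

goldenS-nonempty : ∀ n → Σ Letter λ d → Σ (List Letter) λ v → goldenS (suc n) ≡ d ∷ v
goldenS-nonempty zero          = A , [] , refl
goldenS-nonempty (suc zero)    = B , [] , refl
goldenS-nonempty (suc (suc n)) with goldenS-nonempty (suc n)
... | d , v , S≡ = d , v ++ goldenS (suc n) , cong (_++ goldenS (suc n)) S≡

split-at : ∀ {A : Set} (s : List A) k → k < length s →
  Σ (List A) λ p → Σ A λ c → Σ (List A) λ t → s ≡ p ++ c ∷ t × length p ≡ k
split-at (c ∷ s) zero    _         = [] , c , s , refl , refl
split-at (c ∷ s) (suc k) (s≤s k<∣s∣) with split-at s k k<∣s∣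
... | p , c′ , t , s≡ , |p|≡k = c ∷ p , c′ , t , cong (c ∷_) s≡ , cong suc |p|≡k

charAt-++-∷ : ∀ p c t → charAt (p ++ c ∷ t) (suc (length p)) ≡ just c
charAt-++-∷ []      c t = refl
charAt-++-∷ (_ ∷ p) c t = charAt-++-∷ p c t

goldenPositions-consecutive : ∀ k → Σ (List ℕ) λ pre → Σ ℕ λ a → Σ Letter λ c → Σ (List ℕ) λ rest →
  goldenPositions (3 + k) ≡ pre ++ a ∷ a + gap c ∷ rest × length pre ≡ k × goldenChar (suc k) ≡ just c
goldenPositions-consecutive k
  with split-at (goldenS (3 + k)) k (<-trans (n<1+n k) (length-goldenS (suc k))) | goldenS-nonempty (suc k)
... | p , c , t , S≡ , |p|≡k | d , v , S′≡ with positions-++-∷ (endpoint (L 0) p + gap c) t v d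
... | rest , positions≡ = positions (L 0) p , endpoint (L 0) p , c , rest , U≡ , trans (length-positions (L 0) p) |p|≡k , char≡
  where
  a : ℕ
  a = endpoint (L 0) p
  open ≡-Reasoning
  U≡ : goldenPositions (3 + k) ≡ positions (L 0) p ++ a ∷ a + gap c ∷ rest
  U≡ = begin
    positions (L 0) (goldenS (3 + k) ++ goldenS (2 + k))       ≡⟨ cong₂ (λ s s′ → positions (L 0) (s ++ s′)) S≡ S′≡ ⟩
    positions (L 0) ((p ++ c ∷ t) ++ d ∷ v)                    ≡⟨ cong (positions (L 0)) (++-assoc p (c ∷ t) (d ∷ v)) ⟩
    positions (L 0) (p ++ c ∷ t ++ d ∷ v)                      ≡⟨ positions-++ (L 0) p (c ∷ t ++ d ∷ v) ⟩
    positions (L 0) p ++ a ∷ positions (a + gap c) (t ++ d ∷ v) ≡⟨ cong (λ r → positions (L 0) p ++ a ∷ r) positions≡ ⟩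
    positions (L 0) p ++ a ∷ a + gap c ∷ rest                  ∎
  char≡ : goldenChar (suc k) ≡ just c
  char≡ = begin
    charAt (goldenS (suc k + 2)) (suc k)      ≡⟨ cong (λ i → charAt (goldenS i) (suc k)) (+-comm (suc k) 2) ⟩
    charAt (goldenS (3 + k)) (suc k)          ≡⟨ cong (λ s → charAt s (suc k)) S≡ ⟩
    charAt (p ++ c ∷ t) (suc k)               ≡⟨ cong (λ i → charAt (p ++ c ∷ t) (suc i)) |p|≡k ⟨
    charAt (p ++ c ∷ t) (suc (length p))      ≡⟨ charAt-++-∷ p c t ⟩
    just c                                    ∎

lemma4p2 : (j : ℕ) → 1 ≤ j →
    Σ ℕ λ a → Σ ℕ λ b → Q0 j a × Q0 (suc j) b ×
      (Σ Letter λ c → goldenChar j ≡ just c × b ≡ a + gap c)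
lemma4p2 zero    ()
lemma4p2 (suc k) _ with goldenPositions-consecutive k
... | pre , a , c , rest , U≡ , |pre|≡k , char≡ =
  a , a + gap c ,
  Q0-at (3 + k) pre a (a + gap c ∷ rest) U≡ |pre|≡k ,
  Q0-at (3 + k) (pre ++ a ∷ []) (a + gap c) rest
    (trans U≡ (sym (++-assoc pre (a ∷ []) (a + gap c ∷ rest))))
    (trans (length-++ pre) (trans (+-comm (length pre) 1) (cong suc |pre|≡k))) ,
  c , char≡ , refl
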